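{- Let $G$ and $H$ be non-trivial graphs. The graph $G\oplus H$ is not connected if and only if both $G$ and $H$ have isolated vertices, or $G$ is an empty graph and $H$ is not connected, or $H$ is an empty graph and $G$ is not connected.
   Context: All graphs are finite and simple. A graph is non-trivial if it has at least two vertices; a graph is called empty if it is edgeless and non-trivial. The Cartesian sum $G\oplus H$ of graphs $G=(V_1,E_1)$ and $H=(V_2,E_2)$ has vertex set $V_1\times V_2$, with $(a,b)(c,d)$ an edge if and only if $ac\in E_1$ or $bd\in E_2$. -}

module Defs where

open import Data.Nat using (ℕ; _≤_)
open import Data.Fin using (Fin)
open import Data.Bool using (Bool; T; _∨_)
open import Data.Empty using (⊥)
open import Data.Product using (_×_; _,_; ∃)
open import Relation.Nullary using (¬_)
open import Relation.Binary.PropositionalEquality using (_≡_)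
open import Relation.Binary.Construct.Closure.ReflexiveTransitive using (Star)

record Graph (n : ℕ) : Set where
  field
    adj    : Fin n → Fin n → Bool
    adj-sym    : ∀ u v → adj u v ≡ adj v u
    adj-irrefl : ∀ u → ¬ T (adj u u)

open Graph public

Adj : ∀ {n} → Graph n → Fin n → Fin n → Set
Adj G u v = T (adj G u v)

ConnectedRel : {V : Set} → (V → V → Set) → Set
ConnectedRel {V} R = ∀ (u v : V) → Star R u v

Connected : ∀ {n} → Graph n → Set
Connected G = ConnectedRel (Adj G)

NonTrivial : ∀ {n} → Graph n → Set
NonTrivial {n} G = 2 ≤ n

HasIsolatedVertex : ∀ {n} → Graph n → Set
HasIsolatedVertex {n} G = ∃ λ (v : Fin n) → ∀ (u : Fin n) → ¬ Adj G v u

EmptyGraph : ∀ {n} → Graph n → Set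
EmptyGraph {n} G = NonTrivial G × (∀ (u v : Fin n) → ¬ Adj G u v)

-- Cartesian sum G ⊕ H: vertex set Fin n × Fin m, (a,b)(c,d) adjacent iff
-- ac ∈ E(G) or bd ∈ E(H).
SumAdj : ∀ {n m} → Graph n → Graph m → (Fin n × Fin m) → (Fin n × Fin m) → Set
SumAdj G H (a , b) (c , d) = T (adj G a c ∨ adj H b d)

-- If G has no isolated vertex, then G ⊕ H is connected as soon as H has an
-- edge (jump to that edge along G-edges, cross it, jump back), and as soon as
-- G is connected; so if G ⊕ H is disconnected, H is empty and G is not
-- connected. Conversely, a pair of isolated vertices is isolated in G ⊕ H,
-- and when H is edgeless every walk in G ⊕ H projects to a walk in G.
-- Since G ⊕ H ≅ H ⊕ G, these one-sided facts cover all cases.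
module Submission where

open import Defs
open import Data.Nat using (_≤_; s≤s; z≤n)
open import Data.Fin using (Fin; zero; punchIn)
open import Data.Fin.Properties using (any?; punchInᵢ≢i)
open import Data.Bool using (T)
open import Data.Bool.Properties using (T-∨; ∨-comm)
open import Data.Empty using (⊥-elim)
open import Data.Product using (_×_; _,_; ∃; ∃₂; proj₁; proj₂; swap)
open import Data.Sum using (_⊎_; inj₁; inj₂; [_,_])
open import Function using (_∘_; id)
open import Function.Bundles using (_⇔_; mk⇔; Equivalence)
open import Relation.Nullary using (¬_; yes; no; ¬?)
open import Relation.Nullary.Decidable using (T?)
open import Relation.Binary.PropositionalEquality using (_≢_; refl; sym; cong; subst)
open import Relation.Binary.Construct.Closure.ReflexiveTransitive using (Star; ε; _◅_; gmap)

Star-first-step : ∀ {V : Set} {R : V → V → Set} {u v} → Star R u v → u ≢ v → ∃ (R u)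
Star-first-step ε u≢u = ⊥-elim (u≢u refl)
Star-first-step (r ◅ _) _ = _ , r

¬connected-of-isolated : ∀ {V : Set} {R : V → V → Set} {v w} →
  (∀ u → ¬ R v u) → v ≢ w → ¬ ConnectedRel R
¬connected-of-isolated {v = v} {w} isolated v≢w connected =
  isolated _ (proj₂ (Star-first-step (connected v w) v≢w))

∃-other : ∀ {n} → 2 ≤ n → (v : Fin n) → ∃ λ w → v ≢ w
∃-other (s≤s (s≤s z≤n)) v = punchIn v zero , punchInᵢ≢i v zero ∘ sym

some-vertex : ∀ {n} → 2 ≤ n → Fin n
some-vertex (s≤s _) = zero

NoIsolatedVertex : ∀ {n} → Graph n → Set
NoIsolatedVertex {n} G = ∀ (v : Fin n) → ∃ (Adj G v)

HasEdge : ∀ {n} → Graph n → Set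
HasEdge G = ∃₂ (Adj G)

Edgeless : ∀ {n} → Graph n → Set
Edgeless {n} G = ∀ (u v : Fin n) → ¬ Adj G u v

module _ {n} (G : Graph n) where

  Adj-sym : ∀ {u v} → Adj G u v → Adj G v u
  Adj-sym {u} {v} = subst T (adj-sym G u v)

  isolated-or-not : HasIsolatedVertex G ⊎ NoIsolatedVertex G
  isolated-or-not with any? (λ v → ¬? (any? (λ u → T? (adj G v u))))
  ... | yes (v , no-neighbour) = inj₁ (v , λ u uv → no-neighbour (u , uv))
  ... | no ¬isolated = inj₂ neighbour
    where
    neighbour : NoIsolatedVertex G
    neighbour v with any? (λ u → T? (adj G v u))
    ... | yes found = found
    ... | no none = ⊥-elim (¬isolated (v , none))

  edge-or-edgeless : HasEdge G ⊎ Edgeless G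
  edge-or-edgeless with any? (λ u → any? (λ v → T? (adj G u v)))
  ... | yes edge = inj₁ edge
  ... | no none = inj₂ (λ u v uv → none (u , v , uv))

  connected⇒noIsolated : NonTrivial G → Connected G → NoIsolatedVertex G
  connected⇒noIsolated nt connected v =
    let w , v≢w = ∃-other nt v in Star-first-step (connected v w) v≢w

module _ {n m} (G : Graph n) (H : Graph m) where

  ⊕-adjˡ : ∀ {a b c d} → Adj G a c → SumAdj G H (a , b) (c , d)
  ⊕-adjˡ {a} {b} {c} {d} = Equivalence.from (T-∨ {adj G a c} {adj H b d}) ∘ inj₁

  ⊕-adjʳ : ∀ {a b c d} → Adj H b d → SumAdj G H (a , b) (c , d)
  ⊕-adjʳ {a} {b} {c} {d} = Equivalence.from (T-∨ {adj G a c} {adj H b d}) ∘ inj₂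

  ⊕-adj-cases : ∀ {a b c d} → SumAdj G H (a , b) (c , d) → Adj G a c ⊎ Adj H b d
  ⊕-adj-cases {a} {b} {c} {d} = Equivalence.to (T-∨ {adj G a c} {adj H b d})

  ⊕-adj-swap : ∀ {p q} → SumAdj G H p q → SumAdj H G (swap p) (swap q)
  ⊕-adj-swap {a , b} {c , d} = subst T (∨-comm (adj G a c) (adj H b d))

  ⊕-connected-swap : ConnectedRel (SumAdj G H) → ConnectedRel (SumAdj H G)
  ⊕-connected-swap connected p q = gmap swap ⊕-adj-swap (connected (swap p) (swap q))

  ⊕-liftˡ : ∀ {a c} d → Star (Adj G) a c → Star (SumAdj G H) (a , d) (c , d)
  ⊕-liftˡ d = gmap (_, d) ⊕-adjˡ

  ⊕-projˡ : Edgeless H → ∀ {p q} → Star (SumAdj G H) p q → Star (Adj G) (proj₁ p) (proj₁ q)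
  ⊕-projˡ edgeless = gmap proj₁ (λ {p} {q} → [ id , ⊥-elim ∘ edgeless (proj₂ p) (proj₂ q) ] ∘ ⊕-adj-cases)

  ⊕-connected-of-connectedˡ : NonTrivial G → Connected G → ConnectedRel (SumAdj G H)
  ⊕-connected-of-connectedˡ nt connected (a , b) (c , d) =
    let a′ , aa′ = connected⇒noIsolated G nt connected a
    in ⊕-adjˡ aa′ ◅ ⊕-liftˡ d (connected a′ c)

  ⊕-connected-of-noIsolated-edge : NoIsolatedVertex G → HasEdge H → ConnectedRel (SumAdj G H)
  ⊕-connected-of-noIsolated-edge neighbour (h₁ , h₂ , h₁h₂) (a , b) (c , d) =
    let a′ , aa′ = neighbour a
        c′ , cc′ = neighbour c
    in ⊕-adjˡ {b = b} {d = h₁} aa′ ◅ ⊕-adjʳ h₁h₂ ◅ ⊕-adjˡ {d = d} (Adj-sym G cc′) ◅ ε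

  ⊕-disconnected-of-isolated : NonTrivial H → HasIsolatedVertex G → HasIsolatedVertex H →
    ¬ ConnectedRel (SumAdj G H)
  ⊕-disconnected-of-isolated nt (g , g-isolated) (h , h-isolated) =
    let h′ , h≢h′ = ∃-other nt h
    in ¬connected-of-isolated {v = g , h} {w = g , h′}
         (λ (c , d) → [ g-isolated c , h-isolated d ] ∘ ⊕-adj-cases)
         (h≢h′ ∘ cong proj₂)

  ⊕-disconnected-of-emptyʳ : EmptyGraph H × ¬ Connected G → ¬ ConnectedRel (SumAdj G H)
  ⊕-disconnected-of-emptyʳ ((nt , edgeless) , ¬connected) connected =
    let h = some-vertex nt
    in ¬connected (λ u v → ⊕-projˡ edgeless (connected (u , h) (v , h)))

  ⊕-disconnected-noIsolatedˡ : NonTrivial G → NonTrivial H → NoIsolatedVertex G →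
    ¬ ConnectedRel (SumAdj G H) → EmptyGraph H × ¬ Connected G
  ⊕-disconnected-noIsolatedˡ ntG ntH neighbour disconnected with edge-or-edgeless H
  ... | inj₁ edge = ⊥-elim (disconnected (⊕-connected-of-noIsolated-edge neighbour edge))
  ... | inj₂ edgeless = (ntH , edgeless) , disconnected ∘ ⊕-connected-of-connectedˡ ntG

corollary1 : ∀ {n m} (G : Graph n) (H : Graph m) → NonTrivial G → NonTrivial H →
    (¬ ConnectedRel (SumAdj G H)) ⇔
      ((HasIsolatedVertex G × HasIsolatedVertex H)
        ⊎ (EmptyGraph G × ¬ Connected H)
        ⊎ (EmptyGraph H × ¬ Connected G))
corollary1 G H ntG ntH = mk⇔ classify exclude
  where
  classify : ¬ ConnectedRel (SumAdj G H) →
    (HasIsolatedVertex G × HasIsolatedVertex H)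
      ⊎ (EmptyGraph G × ¬ Connected H) ⊎ (EmptyGraph H × ¬ Connected G)
  classify disconnected with isolated-or-not G | isolated-or-not H
  ... | inj₁ isoG | inj₁ isoH = inj₁ (isoG , isoH)
  ... | inj₁ _ | inj₂ neighbourH = inj₂ (inj₁
    (⊕-disconnected-noIsolatedˡ H G ntH ntG neighbourH (disconnected ∘ ⊕-connected-swap H G)))
  ... | inj₂ neighbourG | _ = inj₂ (inj₂
    (⊕-disconnected-noIsolatedˡ G H ntG ntH neighbourG disconnected))

  exclude : (HasIsolatedVertex G × HasIsolatedVertex H)
      ⊎ (EmptyGraph G × ¬ Connected H) ⊎ (EmptyGraph H × ¬ Connected G) →
    ¬ ConnectedRel (SumAdj G H)
  exclude (inj₁ (isoG , isoH)) = ⊕-disconnected-of-isolated G H ntH isoG isoH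
  exclude (inj₂ (inj₁ emptyG)) = ⊕-disconnected-of-emptyʳ H G emptyG ∘ ⊕-connected-swap G H
  exclude (inj₂ (inj₂ emptyH)) = ⊕-disconnected-of-emptyʳ G H emptyH
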